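{- For every $m\in\mathbb{N}$, as an identity of rational functions in indeterminates $x,y$, \[ \frac{1-x^{m+1}y^{m+1}}{(1-xy)(1-x)^m(1-y)^m}=\sum_{r=0}^{m}\sum_{s=0}^{m-r}\binom{m-r}{s}\binom{m-s}{r}\frac{x^ry^s}{(1-x)^{r+s}(1-y)^{r+s}}. \]
   Context: $\mathbb{N}$ denotes the positive integers. -}

module Defs where

open import Data.Nat using (ℕ; zero; suc)
import Data.Integer as ℤ
open import Data.Rational using (ℚ; 0ℚ; 1ℚ; _+_; _*_; _/_)

_^ℚ_ : ℚ → ℕ → ℚ
q ^ℚ zero = 1ℚ
q ^ℚ suc n = q * (q ^ℚ n)

sumTo : ℕ → (ℕ → ℚ) → ℚ
sumTo zero f = f 0
sumTo (suc n) f = sumTo n f + f (suc n)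

ℕ→ℚ : ℕ → ℚ
ℕ→ℚ n = ℤ.+ n / 1

{-# OPTIONS --safe #-}
module Submission where

-- Put a = 1/(1-x), b = 1/(1-y), X = xab and Y = yab. Then the summand on the right is
-- C(m-r,s) C(m-s,r) X^r Y^s, so the right-hand side is the polynomial
-- P_m = Σ C(m-r,s) C(m-s,r) X^r Y^s, and Pascal's rule in both binomials gives
-- P_{m+2} = (1+X+Y) P_{m+1} - XY P_m. Since (1-x)(1-y) + x + y = 1 + xy, we have
-- 1 + X + Y = (1+xy)ab and XY = xy(ab)^2, so the left-hand side (1 + xy + ... + (xy)^m)(ab)^m
-- satisfies the same recurrence. Both sequences start with 1 and 1 + X + Y.

open import Defs
open import Data.Nat using (ℕ; zero; suc; _≤_; _<_; _∸_; _≤′_; ≤′-refl; ≤′-step; s≤s)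
  renaming (_+_ to _+ℕ_; _*_ to _*ℕ_)
open import Data.Nat.Properties
  using (_<?_; ≮⇒≥; ≤-<-trans; <-≤-trans; ≤′⇒≤; ≤⇒≤′; ≤-refl; ≤-pred; +-suc; +-monoʳ-<;
         +-∸-assoc; *-zeroʳ; ∸-monoˡ-<; m≤m+n; m≤n+m; m≤n+m∸n; m∸n≤m; m<n⇒m<1+n;
         m+n≤o⇒m≤o; m+n≤o⇒n≤o; m+n∸m≡n)
import Data.Nat.Tactic.RingSolver as ℕ-Solver
open import Data.Nat.Combinatorics using (_C_; nCk+nC[k+1]≡[n+1]C[k+1])
open import Data.Nat.Combinatorics.Specification using (k>n⇒nCk≡0)
import Data.Integer as ℤ
import Data.Integer.Properties as ℤ
open import Data.Rational using (ℚ; 0ℚ; 1ℚ; _+_; _-_; _*_; 1/_; NonZero; toℚᵘ)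
open import Data.Rational.Properties
  using (toℚᵘ-injective; toℚᵘ-fromℚᵘ; toℚᵘ-homo-+; toℚᵘ-homo-*; +-0-commutativeMonoid;
         +-identityʳ; +-identityˡ; +-assoc; *-assoc; *-identityˡ; *-identityʳ; *-zeroˡ;
         *-distribˡ-+; *-distribʳ-+; *-inverseʳ)
open import Data.Rational.Unnormalised as ℚᵘ using (ℚᵘ; mkℚᵘ; *≡*)
import Data.Rational.Unnormalised.Properties as ℚᵘ
open import Data.Rational.Solver using (module +-*-Solver)
open +-*-Solver using (solve; _:+_; _:-_; _:*_; _:=_; con)
open import Algebra.Bundles using (CommutativeMonoid)
open import Algebra.Properties.CommutativeSemigroup
  (CommutativeMonoid.commutativeSemigroup +-0-commutativeMonoid) using (interchange)
open import Function using (_∘_)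
open import Relation.Nullary using (yes; no)
open import Relation.Binary.PropositionalEquality

ℕ→ℚᵘ : ℕ → ℚᵘ
ℕ→ℚᵘ n = mkℚᵘ (ℤ.+ n) 0

toℚᵘ-ℕ→ℚ : ∀ n → toℚᵘ (ℕ→ℚ n) ℚᵘ.≃ ℕ→ℚᵘ n
toℚᵘ-ℕ→ℚ n = toℚᵘ-fromℚᵘ (ℕ→ℚᵘ n)

ℕ→ℚ-homo-+ : ∀ a b → ℕ→ℚ (a +ℕ b) ≡ ℕ→ℚ a + ℕ→ℚ b
ℕ→ℚ-homo-+ a b = toℚᵘ-injective (begin-equality
  toℚᵘ (ℕ→ℚ (a +ℕ b))              ≃⟨ toℚᵘ-ℕ→ℚ (a +ℕ b) ⟩
  ℕ→ℚᵘ (a +ℕ b)                     ≃⟨ *≡* (cong (ℤ._* ℤ.+ 1) numerators) ⟩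
  ℕ→ℚᵘ a ℚᵘ.+ ℕ→ℚᵘ b                ≃⟨ ℚᵘ.+-cong (toℚᵘ-ℕ→ℚ a) (toℚᵘ-ℕ→ℚ b) ⟨
  toℚᵘ (ℕ→ℚ a) ℚᵘ.+ toℚᵘ (ℕ→ℚ b)   ≃⟨ toℚᵘ-homo-+ (ℕ→ℚ a) (ℕ→ℚ b) ⟨
  toℚᵘ (ℕ→ℚ a + ℕ→ℚ b)             ∎)
  where
  open ℚᵘ.≤-Reasoning
  numerators : ℤ.+ (a +ℕ b) ≡ ℤ.+ a ℤ.* ℤ.+ 1 ℤ.+ ℤ.+ b ℤ.* ℤ.+ 1
  numerators = trans (ℤ.pos-+ a b)
                     (sym (cong₂ ℤ._+_ (ℤ.*-identityʳ (ℤ.+ a)) (ℤ.*-identityʳ (ℤ.+ b))))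

ℕ→ℚ-homo-* : ∀ a b → ℕ→ℚ (a *ℕ b) ≡ ℕ→ℚ a * ℕ→ℚ b
ℕ→ℚ-homo-* a b = toℚᵘ-injective (begin-equality
  toℚᵘ (ℕ→ℚ (a *ℕ b))              ≃⟨ toℚᵘ-ℕ→ℚ (a *ℕ b) ⟩
  ℕ→ℚᵘ (a *ℕ b)                     ≃⟨ *≡* (cong (ℤ._* ℤ.+ 1) (ℤ.pos-* a b)) ⟩
  ℕ→ℚᵘ a ℚᵘ.* ℕ→ℚᵘ b                ≃⟨ ℚᵘ.*-cong (toℚᵘ-ℕ→ℚ a) (toℚᵘ-ℕ→ℚ b) ⟨
  toℚᵘ (ℕ→ℚ a) ℚᵘ.* toℚᵘ (ℕ→ℚ b)   ≃⟨ toℚᵘ-homo-* (ℕ→ℚ a) (ℕ→ℚ b) ⟨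
  toℚᵘ (ℕ→ℚ a * ℕ→ℚ b)             ∎)
  where open ℚᵘ.≤-Reasoning

sumTo-cong : ∀ n {f g : ℕ → ℚ} → (∀ i → f i ≡ g i) → sumTo n f ≡ sumTo n g
sumTo-cong zero    f≗g = f≗g 0
sumTo-cong (suc n) f≗g = cong₂ _+_ (sumTo-cong n f≗g) (f≗g (suc n))

sumTo-zero : ∀ n {f : ℕ → ℚ} → (∀ i → f i ≡ 0ℚ) → sumTo n f ≡ 0ℚ
sumTo-zero zero    f≗0 = f≗0 0
sumTo-zero (suc n) f≗0 = cong₂ _+_ (sumTo-zero n f≗0) (f≗0 (suc n))

sumTo-+ : ∀ n (f g : ℕ → ℚ) → sumTo n (λ i → f i + g i) ≡ sumTo n f + sumTo n g
sumTo-+ zero    f g = refl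
sumTo-+ (suc n) f g = trans (cong (_+ (f (suc n) + g (suc n))) (sumTo-+ n f g))
                            (interchange (sumTo n f) (sumTo n g) (f (suc n)) (g (suc n)))

sumTo-*ˡ : ∀ n c (f : ℕ → ℚ) → sumTo n (λ i → c * f i) ≡ c * sumTo n f
sumTo-*ˡ zero    c f = refl
sumTo-*ˡ (suc n) c f = trans (cong (_+ c * f (suc n)) (sumTo-*ˡ n c f)) (sym (*-distribˡ-+ c _ _))

sumTo-unfoldˡ : ∀ n (f : ℕ → ℚ) → sumTo (suc n) f ≡ f 0 + sumTo n (f ∘ suc)
sumTo-unfoldˡ zero    f = refl
sumTo-unfoldˡ (suc n) f =
  trans (cong (_+ f (suc (suc n))) (sumTo-unfoldˡ n f)) (+-assoc (f 0) _ _)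

sumTo-∘suc : ∀ n {f : ℕ → ℚ} → f 0 ≡ 0ℚ → f (suc n) ≡ 0ℚ →
             sumTo n (f ∘ suc) ≡ sumTo n f
sumTo-∘suc n {f} f0≡0 f[1+n]≡0 = begin
  sumTo n (f ∘ suc)        ≡⟨ +-identityˡ _ ⟨
  0ℚ + sumTo n (f ∘ suc)   ≡⟨ cong (_+ sumTo n (f ∘ suc)) f0≡0 ⟨
  f 0 + sumTo n (f ∘ suc)  ≡⟨ sumTo-unfoldˡ n f ⟨
  sumTo n f + f (suc n)    ≡⟨ cong (sumTo n f +_) f[1+n]≡0 ⟩
  sumTo n f + 0ℚ           ≡⟨ +-identityʳ _ ⟩
  sumTo n f                ∎
  where open ≡-Reasoning

sumTo-extend : ∀ {n N} (f : ℕ → ℚ) → (∀ i → n < i → f i ≡ 0ℚ) → n ≤′ N →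
               sumTo N f ≡ sumTo n f
sumTo-extend f f≗0 ≤′-refl        = refl
sumTo-extend f f≗0 (≤′-step n≤′N) =
  trans (cong₂ _+_ (sumTo-extend f f≗0 n≤′N) (f≗0 _ (s≤s (≤′⇒≤ n≤′N)))) (+-identityʳ _)

^ℚ-distribˡ-+-* : ∀ p m n → p ^ℚ (m +ℕ n) ≡ p ^ℚ m * p ^ℚ n
^ℚ-distribˡ-+-* p zero    n = sym (*-identityˡ _)
^ℚ-distribˡ-+-* p (suc m) n = trans (cong (p *_) (^ℚ-distribˡ-+-* p m n)) (sym (*-assoc p _ _))

^ℚ-distribʳ-* : ∀ p q n → (p * q) ^ℚ n ≡ p ^ℚ n * q ^ℚ n
^ℚ-distribʳ-* p q zero    = refl
^ℚ-distribʳ-* p q (suc n) = trans (cong ((p * q) *_) (^ℚ-distribʳ-* p q n))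
  (solve 4 (λ p q u v → (p :* q) :* (u :* v) := (p :* u) :* (q :* v)) refl p q (p ^ℚ n) (q ^ℚ n))

SatisfiesRecurrence : ℚ → ℚ → (ℕ → ℚ) → Set
SatisfiesRecurrence p q u = ∀ m → u (2 +ℕ m) ≡ p * u (1 +ℕ m) - q * u m

recurrence-unique : ∀ p q {u v} → SatisfiesRecurrence p q u → SatisfiesRecurrence p q v →
                    u 0 ≡ v 0 → u 1 ≡ v 1 → ∀ m → u m ≡ v m
recurrence-unique p q {u} {v} rec-u rec-v u0≡v0 u1≡v1 = go
  where
  go : ∀ m → u m ≡ v m
  go zero          = u0≡v0
  go (suc zero)    = u1≡v1
  go (suc (suc m)) =
    trans (rec-u m) (trans (cong₂ (λ s t → p * s - q * t) (go (suc m)) (go m)) (sym (rec-v m)))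

-- c : Coeffs stands for the polynomial Σ c r s X^r Y^s.
Coeffs : Set
Coeffs = ℕ → ℕ → ℕ

DegreeAtMost : ℕ → Coeffs → Set
DegreeAtMost m c = ∀ r s → m < r +ℕ s → c r s ≡ 0

infixl 6 _⊕_

_⊕_ : Coeffs → Coeffs → Coeffs
(c ⊕ d) r s = c r s +ℕ d r s

shiftX : Coeffs → Coeffs
shiftX c zero    s = 0
shiftX c (suc r) s = c r s

shiftY : Coeffs → Coeffs
shiftY c r zero    = 0
shiftY c r (suc s) = c r s

shiftY-degree : ∀ {m c} → DegreeAtMost m c → DegreeAtMost (suc m) (shiftY c)
shiftY-degree     deg r zero    _         = refl
shiftY-degree {m} deg r (suc s) 1+m<r+1+s =
  deg r s (≤-pred (subst (suc m <_) (+-suc r s) 1+m<r+1+s))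

coeff : ℕ → Coeffs
coeff m r s = ((m ∸ r) C s) *ℕ ((m ∸ s) C r)

coeff-degree : ∀ m → DegreeAtMost m (coeff m)
coeff-degree m r s m<r+s with m <? r
... | yes m<r = trans (cong (((m ∸ r) C s) *ℕ_) (k>n⇒nCk≡0 (≤-<-trans (m∸n≤m m s) m<r)))
                      (*-zeroʳ ((m ∸ r) C s))
... | no  m≮r = cong (_*ℕ ((m ∸ s) C r)) (k>n⇒nCk≡0 m∸r<s)
  where
  m∸r<s : m ∸ r < s
  m∸r<s = subst (m ∸ r <_) (m+n∸m≡n r s) (∸-monoˡ-< m<r+s (≮⇒≥ m≮r))

pascal-product : ∀ p q r s →
  (suc p C suc s) *ℕ (suc q C suc r) +ℕ (p C s) *ℕ (q C r)
    ≡ (p C suc s) *ℕ (q C suc r) +ℕ (suc p C suc s) *ℕ (q C r) +ℕ (p C s) *ℕ (suc q C suc r)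
pascal-product p q r s
  rewrite sym (nCk+nC[k+1]≡[n+1]C[k+1] p s) | sym (nCk+nC[k+1]≡[n+1]C[k+1] q r)
  = expand (p C s) (p C suc s) (q C r) (q C suc r)
  where
  expand : ∀ a b d e →
    (a +ℕ b) *ℕ (d +ℕ e) +ℕ a *ℕ d ≡ b *ℕ e +ℕ (a +ℕ b) *ℕ d +ℕ a *ℕ (d +ℕ e)
  expand = ℕ-Solver.solve-∀

-- Coefficientwise, this is P_{m+2} + XY P_m = (1 + X + Y) P_{m+1}.
coeff-recurrence : ∀ m r s →
  (coeff (2 +ℕ m) ⊕ shiftX (shiftY (coeff m))) r s
    ≡ (coeff (1 +ℕ m) ⊕ shiftX (coeff (1 +ℕ m)) ⊕ shiftY (coeff (1 +ℕ m))) r s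
coeff-recurrence m zero    zero    = refl
coeff-recurrence m zero    (suc s)
  rewrite sym (nCk+nC[k+1]≡[n+1]C[k+1] (suc m) s) = boundary (suc m C s) (suc m C suc s)
  where
  boundary : ∀ a b → (a +ℕ b) *ℕ 1 +ℕ 0 ≡ b *ℕ 1 +ℕ 0 +ℕ a *ℕ 1
  boundary = ℕ-Solver.solve-∀
coeff-recurrence m (suc r) zero
  rewrite sym (nCk+nC[k+1]≡[n+1]C[k+1] (suc m) r) = boundary (suc m C r) (suc m C suc r)
  where
  boundary : ∀ a b → 1 *ℕ (a +ℕ b) +ℕ 0 ≡ 1 *ℕ b +ℕ 1 *ℕ a +ℕ 0
  boundary = ℕ-Solver.solve-∀
coeff-recurrence m (suc r) (suc s) with m <? r +ℕ s
... | yes m<r+s =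
  trans (cong₂ _+ℕ_ (coeff-degree (2 +ℕ m) (suc r) (suc s) (s≤s m<r+1+s))
                    (coeff-degree m r s m<r+s))
        (sym (cong₂ _+ℕ_ (cong₂ _+ℕ_ (coeff-degree (suc m) (suc r) (suc s) (m<n⇒m<1+n m<r+1+s))
                                     (coeff-degree (suc m) r (suc s) m<r+1+s))
                         (coeff-degree (suc m) (suc r) s (s≤s m<r+s))))
  where
  m<r+1+s : suc m < r +ℕ suc s
  m<r+1+s = subst (suc m <_) (sym (+-suc r s)) (s≤s m<r+s)
... | no  m≮r+s
  rewrite +-∸-assoc 1 (m+n≤o⇒m≤o r (≮⇒≥ m≮r+s))
        | +-∸-assoc 1 (m+n≤o⇒n≤o r (≮⇒≥ m≮r+s))
  = pascal-product (m ∸ r) (m ∸ s) r s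

module Evaluation (X Y : ℚ) where

  term : Coeffs → ℕ → ℕ → ℚ
  term c r s = ℕ→ℚ (c r s) * (X ^ℚ r * Y ^ℚ s)

  eval : ℕ → Coeffs → ℚ
  eval N c = sumTo N (λ r → sumTo N (term c r))

  term-vanishes : ∀ c r s → c r s ≡ 0 → term c r s ≡ 0ℚ
  term-vanishes c r s c≡0 =
    trans (cong (λ k → ℕ→ℚ k * (X ^ℚ r * Y ^ℚ s)) c≡0) (*-zeroˡ (X ^ℚ r * Y ^ℚ s))

  eval-cong : ∀ N {c d} → (∀ r s → c r s ≡ d r s) → eval N c ≡ eval N d
  eval-cong N c≗d = sumTo-cong N (λ r → sumTo-cong N (λ s → cong (λ k → ℕ→ℚ k * _) (c≗d r s)))

  eval-⊕ : ∀ N c d → eval N (c ⊕ d) ≡ eval N c + eval N d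
  eval-⊕ N c d = begin
    eval N (c ⊕ d)
      ≡⟨ sumTo-cong N (λ r → sumTo-cong N (term-⊕ r)) ⟩
    sumTo N (λ r → sumTo N (λ s → term c r s + term d r s))
      ≡⟨ sumTo-cong N (λ r → sumTo-+ N (term c r) (term d r)) ⟩
    sumTo N (λ r → sumTo N (term c r) + sumTo N (term d r))
      ≡⟨ sumTo-+ N _ _ ⟩
    eval N c + eval N d ∎
    where
    open ≡-Reasoning
    term-⊕ : ∀ r s → term (c ⊕ d) r s ≡ term c r s + term d r s
    term-⊕ r s = trans (cong (_* (X ^ℚ r * Y ^ℚ s)) (ℕ→ℚ-homo-+ (c r s) (d r s)))
                       (*-distribʳ-+ (X ^ℚ r * Y ^ℚ s) (ℕ→ℚ (c r s)) (ℕ→ℚ (d r s)))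

  eval-extend : ∀ {m N c} → DegreeAtMost m c → m ≤ N → eval N c ≡ eval m c
  eval-extend {m} {N} {c} deg m≤N = begin
    sumTo N (λ r → sumTo N (term c r))
      ≡⟨ sumTo-cong N (λ r → sumTo-extend (term c r) (column-vanishes r) (≤⇒≤′ m≤N)) ⟩
    sumTo N (λ r → sumTo m (term c r))
      ≡⟨ sumTo-extend _ (λ r m<r → sumTo-zero m (row-vanishes r m<r)) (≤⇒≤′ m≤N) ⟩
    sumTo m (λ r → sumTo m (term c r)) ∎
    where
    open ≡-Reasoning
    column-vanishes : ∀ r s → m < s → term c r s ≡ 0ℚ
    column-vanishes r s m<s = term-vanishes c r s (deg r s (<-≤-trans m<s (m≤n+m s r)))
    row-vanishes : ∀ r → m < r → ∀ s → term c r s ≡ 0ℚ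
    row-vanishes r m<r s = term-vanishes c r s (deg r s (<-≤-trans m<r (m≤m+n r s)))

  X*eval : ∀ {m N c} → DegreeAtMost m c → m < N → X * eval N c ≡ eval N (shiftX c)
  X*eval {m} {N} {c} deg m<N = begin
    X * eval N c
      ≡⟨ sumTo-*ˡ N X _ ⟨
    sumTo N (λ r → X * sumTo N (term c r))
      ≡⟨ sumTo-cong N (λ r → trans (sym (sumTo-*ˡ N X (term c r))) (sumTo-cong N (raise r))) ⟩
    sumTo N (λ r → sumTo N (term (shiftX c) (suc r)))
      ≡⟨ sumTo-∘suc N (sumTo-zero N (λ s → term-vanishes (shiftX c) 0 s refl))
                      (sumTo-zero N (λ s → term-vanishes (shiftX c) (suc N) s (row-N-vanishes s))) ⟩
    eval N (shiftX c) ∎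
    where
    open ≡-Reasoning
    raise : ∀ r s → X * term c r s ≡ term (shiftX c) (suc r) s
    raise r s = solve 4 (λ X k u v → X :* (k :* (u :* v)) := k :* ((X :* u) :* v))
                        refl X (ℕ→ℚ (c r s)) (X ^ℚ r) (Y ^ℚ s)
    row-N-vanishes : ∀ s → c N s ≡ 0
    row-N-vanishes s = deg N s (<-≤-trans m<N (m≤m+n N s))

  Y*eval : ∀ {m N c} → DegreeAtMost m c → m < N → Y * eval N c ≡ eval N (shiftY c)
  Y*eval {m} {N} {c} deg m<N = begin
    Y * eval N c
      ≡⟨ sumTo-*ˡ N Y _ ⟨
    sumTo N (λ r → Y * sumTo N (term c r))
      ≡⟨ sumTo-cong N (λ r → trans (sym (sumTo-*ˡ N Y (term c r))) (sumTo-cong N (raise r))) ⟩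
    sumTo N (λ r → sumTo N (term (shiftY c) r ∘ suc))
      ≡⟨ sumTo-cong N (λ r → sumTo-∘suc N (term-vanishes (shiftY c) r 0 refl)
                                          (term-vanishes (shiftY c) r (suc N) (column-N-vanishes r))) ⟩
    eval N (shiftY c) ∎
    where
    open ≡-Reasoning
    raise : ∀ r s → Y * term c r s ≡ term (shiftY c) r (suc s)
    raise r s = solve 4 (λ Y k u v → Y :* (k :* (u :* v)) := k :* (u :* (Y :* v)))
                        refl Y (ℕ→ℚ (c r s)) (X ^ℚ r) (Y ^ℚ s)
    column-N-vanishes : ∀ r → c r N ≡ 0
    column-N-vanishes r = deg r N (<-≤-trans m<N (m≤n+m N r))

  poly : ℕ → ℚ
  poly m = eval m (coeff m)

  poly-0 : poly 0 ≡ 1ℚ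
  poly-0 = refl

  poly-1 : poly 1 ≡ 1ℚ + X + Y
  poly-1 = solve 2 (λ X Y →
    con 1ℚ :* (con 1ℚ :* con 1ℚ) :+ con 1ℚ :* (con 1ℚ :* (Y :* con 1ℚ))
      :+ (con 1ℚ :* ((X :* con 1ℚ) :* con 1ℚ) :+ con 0ℚ :* ((X :* con 1ℚ) :* (Y :* con 1ℚ)))
    := con 1ℚ :+ X :+ Y) refl X Y

  poly-recurrence : SatisfiesRecurrence (1ℚ + X + Y) (X * Y) poly
  poly-recurrence m = begin
    poly (2 +ℕ m)
      ≡⟨ solve 2 (λ p w → p := p :+ w :- w) refl (poly (2 +ℕ m)) (X * Y * poly m) ⟩
    poly (2 +ℕ m) + X * Y * poly m - X * Y * poly m
      ≡⟨ cong (_- X * Y * poly m) subtraction-free ⟩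
    (1ℚ + X + Y) * poly (1 +ℕ m) - X * Y * poly m ∎
    where
    open ≡-Reasoning
    N = 2 +ℕ m
    k₀ = coeff m
    k₁ = coeff (1 +ℕ m)
    k₂ = coeff (2 +ℕ m)
    subtraction-free : eval N k₂ + X * Y * eval m k₀ ≡ (1ℚ + X + Y) * eval (1 +ℕ m) k₁
    subtraction-free = begin
      eval N k₂ + X * Y * eval m k₀
        ≡⟨ cong (λ e → eval N k₂ + X * Y * e) (eval-extend (coeff-degree m) (m≤n+m m 2)) ⟨
      eval N k₂ + X * Y * eval N k₀
        ≡⟨ cong (eval N k₂ +_) (trans (*-assoc X Y _)
                                      (cong (X *_) (Y*eval (coeff-degree m) (m≤n+m (suc m) 1)))) ⟩
      eval N k₂ + X * eval N (shiftY k₀)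
        ≡⟨ cong (eval N k₂ +_) (X*eval (shiftY-degree (coeff-degree m)) ≤-refl) ⟩
      eval N k₂ + eval N (shiftX (shiftY k₀))
        ≡⟨ eval-⊕ N k₂ (shiftX (shiftY k₀)) ⟨
      eval N (k₂ ⊕ shiftX (shiftY k₀))
        ≡⟨ eval-cong N (coeff-recurrence m) ⟩
      eval N (k₁ ⊕ shiftX k₁ ⊕ shiftY k₁)
        ≡⟨ eval-⊕ N (k₁ ⊕ shiftX k₁) (shiftY k₁) ⟩
      eval N (k₁ ⊕ shiftX k₁) + eval N (shiftY k₁)
        ≡⟨ cong (_+ eval N (shiftY k₁)) (eval-⊕ N k₁ (shiftX k₁)) ⟩
      eval N k₁ + eval N (shiftX k₁) + eval N (shiftY k₁)
        ≡⟨ cong₂ (λ u v → eval N k₁ + u + v) (X*eval (coeff-degree (1 +ℕ m)) ≤-refl)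
                                               (Y*eval (coeff-degree (1 +ℕ m)) ≤-refl) ⟨
      eval N k₁ + X * eval N k₁ + Y * eval N k₁
        ≡⟨ solve 3 (λ X Y e → e :+ X :* e :+ Y :* e := (con 1ℚ :+ X :+ Y) :* e) refl X Y (eval N k₁) ⟩
      (1ℚ + X + Y) * eval N k₁
        ≡⟨ cong ((1ℚ + X + Y) *_) (eval-extend (coeff-degree (1 +ℕ m)) (m≤n+m (suc m) 1)) ⟩
      (1ℚ + X + Y) * eval (1 +ℕ m) k₁ ∎

module RationalFunctions (x y : ℚ)
  .{{_ : NonZero (1ℚ - x * y)}} .{{_ : NonZero (1ℚ - x)}} .{{_ : NonZero (1ℚ - y)}} where

  a b i X Y : ℚ
  a = 1/ (1ℚ - x)
  b = 1/ (1ℚ - y)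
  i = 1/ (1ℚ - x * y)
  X = x * a * b
  Y = y * a * b

  open Evaluation X Y public using (term; term-vanishes; poly; poly-0; poly-1; poly-recurrence)

  lhs : ℕ → ℚ
  lhs m = (1ℚ - (x ^ℚ suc m) * (y ^ℚ suc m)) * i * (a ^ℚ m) * (b ^ℚ m)

  summand : ℕ → ℕ → ℕ → ℚ
  summand m r s = ℕ→ℚ ((m ∸ r) C s) * ℕ→ℚ ((m ∸ s) C r) * (x ^ℚ r) * (y ^ℚ s)
                  * (a ^ℚ (r +ℕ s)) * (b ^ℚ (r +ℕ s))

  rhs : ℕ → ℚ
  rhs m = sumTo m (λ r → sumTo (m ∸ r) (summand m r))

  1+X+Y≡[1+xy]ab : 1ℚ + X + Y ≡ (1ℚ + x * y) * a * b
  1+X+Y≡[1+xy]ab = begin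
    1ℚ + X + Y
      ≡⟨ cong (λ e → e + X + Y) (cong₂ _*_ (*-inverseʳ (1ℚ - x)) (*-inverseʳ (1ℚ - y))) ⟨
    ((1ℚ - x) * a) * ((1ℚ - y) * b) + X + Y
      ≡⟨ solve 4 (λ x y a b → ((con 1ℚ :- x) :* a) :* ((con 1ℚ :- y) :* b) :+ x :* a :* b :+ y :* a :* b
                              := (con 1ℚ :+ x :* y) :* a :* b) refl x y a b ⟩
    (1ℚ + x * y) * a * b ∎
    where open ≡-Reasoning

  lhs-0 : lhs 0 ≡ 1ℚ
  lhs-0 = trans (solve 3 (λ x y i → (con 1ℚ :- (x :* con 1ℚ) :* (y :* con 1ℚ)) :* i :* con 1ℚ :* con 1ℚ
                                   := (con 1ℚ :- x :* y) :* i) refl x y i)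
                (*-inverseʳ (1ℚ - x * y))

  lhs-1 : lhs 1 ≡ 1ℚ + X + Y
  lhs-1 = begin
    lhs 1
      ≡⟨ solve 5 (λ x y a b i →
           (con 1ℚ :- (x :* (x :* con 1ℚ)) :* (y :* (y :* con 1ℚ))) :* i :* (a :* con 1ℚ) :* (b :* con 1ℚ)
           := (con 1ℚ :+ x :* y) :* a :* b :* ((con 1ℚ :- x :* y) :* i)) refl x y a b i ⟩
    (1ℚ + x * y) * a * b * ((1ℚ - x * y) * i)
      ≡⟨ cong ((1ℚ + x * y) * a * b *_) (*-inverseʳ (1ℚ - x * y)) ⟩
    (1ℚ + x * y) * a * b * 1ℚ
      ≡⟨ *-identityʳ _ ⟩
    (1ℚ + x * y) * a * b
      ≡⟨ 1+X+Y≡[1+xy]ab ⟨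
    1ℚ + X + Y ∎
    where open ≡-Reasoning

  lhs-recurrence : SatisfiesRecurrence (1ℚ + X + Y) (X * Y) lhs
  lhs-recurrence m = begin
    lhs (2 +ℕ m)
      ≡⟨ solve 9 (λ x y a b i u v α β →
           (con 1ℚ :- (x :* (x :* u)) :* (y :* (y :* v))) :* i :* (a :* (a :* α)) :* (b :* (b :* β))
           := (con 1ℚ :+ x :* y) :* a :* b :* ((con 1ℚ :- (x :* u) :* (y :* v)) :* i :* (a :* α) :* (b :* β))
              :- x :* a :* b :* (y :* a :* b) :* ((con 1ℚ :- u :* v) :* i :* α :* β))
           refl x y a b i (x ^ℚ suc m) (y ^ℚ suc m) (a ^ℚ m) (b ^ℚ m) ⟩
    (1ℚ + x * y) * a * b * lhs (1 +ℕ m) - X * Y * lhs m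
      ≡⟨ cong (λ e → e * lhs (1 +ℕ m) - X * Y * lhs m) 1+X+Y≡[1+xy]ab ⟨
    (1ℚ + X + Y) * lhs (1 +ℕ m) - X * Y * lhs m ∎
    where open ≡-Reasoning

  summand≡term : ∀ m r s → summand m r s ≡ term (coeff m) r s
  summand≡term m r s = begin
    ℕ→ℚ A * ℕ→ℚ B * x ^ℚ r * y ^ℚ s * a ^ℚ (r +ℕ s) * b ^ℚ (r +ℕ s)
      ≡⟨ cong₂ (λ u v → ℕ→ℚ A * ℕ→ℚ B * x ^ℚ r * y ^ℚ s * u * v)
               (^ℚ-distribˡ-+-* a r s) (^ℚ-distribˡ-+-* b r s) ⟩
    ℕ→ℚ A * ℕ→ℚ B * x ^ℚ r * y ^ℚ s * (a ^ℚ r * a ^ℚ s) * (b ^ℚ r * b ^ℚ s)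
      ≡⟨ solve 8 (λ A B xr ys ar as br bs → A :* B :* xr :* ys :* (ar :* as) :* (br :* bs)
                                            := A :* B :* ((xr :* ar :* br) :* (ys :* as :* bs)))
           refl (ℕ→ℚ A) (ℕ→ℚ B) (x ^ℚ r) (y ^ℚ s) (a ^ℚ r) (a ^ℚ s) (b ^ℚ r) (b ^ℚ s) ⟩
    ℕ→ℚ A * ℕ→ℚ B * ((x ^ℚ r * a ^ℚ r * b ^ℚ r) * (y ^ℚ s * a ^ℚ s * b ^ℚ s))
      ≡⟨ cong₂ _*_ (ℕ→ℚ-homo-* A B) (cong₂ _*_ (power-of-product x r) (power-of-product y s)) ⟨
    term (coeff m) r s ∎
    where
    open ≡-Reasoning
    A = (m ∸ r) C s
    B = (m ∸ s) C r
    power-of-product : ∀ z n → (z * a * b) ^ℚ n ≡ z ^ℚ n * a ^ℚ n * b ^ℚ n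
    power-of-product z n = trans (^ℚ-distribʳ-* (z * a) b n) (cong (_* b ^ℚ n) (^ℚ-distribʳ-* z a n))

  rhs≡poly : ∀ m → rhs m ≡ poly m
  rhs≡poly m = sumTo-cong m (λ r → begin
    sumTo (m ∸ r) (summand m r)       ≡⟨ sumTo-cong (m ∸ r) (summand≡term m r) ⟩
    sumTo (m ∸ r) (term (coeff m) r)  ≡⟨ sumTo-extend _ (beyond-triangle r) (≤⇒≤′ (m∸n≤m m r)) ⟨
    sumTo m (term (coeff m) r)        ∎)
    where
    open ≡-Reasoning
    beyond-triangle : ∀ r s → m ∸ r < s → term (coeff m) r s ≡ 0ℚ
    beyond-triangle r s m∸r<s =
      term-vanishes (coeff m) r s (coeff-degree m r s (≤-<-trans (m≤n+m∸n m r) (+-monoʳ-< r m∸r<s)))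

theorem2p4 : (m : ℕ) → 1 ≤ m → (x y : ℚ)
    → .{{_ : NonZero (1ℚ - x * y)}} → .{{_ : NonZero (1ℚ - x)}} → .{{_ : NonZero (1ℚ - y)}}
    → (1ℚ - (x ^ℚ (suc m)) * (y ^ℚ (suc m))) * (1/ (1ℚ - x * y)) * ((1/ (1ℚ - x)) ^ℚ m) * ((1/ (1ℚ - y)) ^ℚ m)
      ≡ sumTo m (λ r → sumTo (m ∸ r) (λ s →
          ℕ→ℚ ((m ∸ r) C s) * ℕ→ℚ ((m ∸ s) C r) * (x ^ℚ r) * (y ^ℚ s)
            * ((1/ (1ℚ - x)) ^ℚ (r +ℕ s)) * ((1/ (1ℚ - y)) ^ℚ (r +ℕ s))))
theorem2p4 m _ x y = begin
  lhs m   ≡⟨ recurrence-unique (1ℚ + X + Y) (X * Y) lhs-recurrence poly-recurrence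
               (trans lhs-0 (sym poly-0)) (trans lhs-1 (sym poly-1)) m ⟩
  poly m  ≡⟨ rhs≡poly m ⟨
  rhs m   ∎
  where
  open RationalFunctions x y
  open ≡-Reasoning
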